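{- Let $S$ be an ordered arc of $\mathrm{V}_k(\mathbb{F}_q)$ ($k\geqslant 3$), $t=q+k-1-|S|$, $A=\{a_1,\ldots,a_{k-2}\}$ a subset of $S$ of size $k-2$ (ordered as in $S$), and let $f_A(x)=\prod_{i=1}^t\alpha_i(x)$ where $\alpha_1,\ldots,\alpha_t$ are pairwise linearly independent linear forms with $\ker\alpha_i\cap S=A$. If $E$ is a subset of $S$ of size $t+k$ containing $A$, then $$\sum_{e\in E\setminus A} f_A(e)\prod_{u\in E\setminus(A\cup\{e\})} d_A(u,e)^{ -1}=0.$$
   Context: $\mathrm{V}_k(\mathbb{F}_q)$ is the $k$-dimensional vector space over $\mathbb{F}_q$; an arc is a set of vectors in which every $k$-subset is a basis. $\det(v_1,\ldots,v_k)$ is the determinant of the matrix with rows $v_i$ w.r.t. a fixed basis, and $d_A(u,v)=\det(u,v,a_1,\ldots,a_{k-2})$. -}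

module Defs where

open import Level using (0ℓ)
open import Data.Nat using (ℕ; zero; suc)
open import Data.Fin using (Fin; zero; suc; _<_)
open import Data.Fin.Properties using (any?) renaming (_≟_ to _≟ᶠ_)
open import Data.Fin.Subset using (Subset; _∈_)
open import Data.Fin.Subset.Properties using (_∈?_)
open import Data.Bool using (Bool; true; false; if_then_else_; _∧_; not)
open import Data.Product using (∃; _×_; _,_)
open import Function.Bundles using (_↔_)
open import Algebra.Core using (Op₁; Op₂)
open import Algebra.Structures using (IsCommutativeRing)
open import Relation.Nullary using (¬_)
open import Relation.Nullary.Decidable using (⌊_⌋)
open import Relation.Binary.PropositionalEquality using (_≡_)

record FiniteField : Set₁ where
  infixl 7 _*_
  infixl 6 _+_
  field
    Carrier : Set
    _+_ _*_ : Op₂ Carrier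
    -_      : Op₁ Carrier
    0# 1#   : Carrier
    isCommutativeRing : IsCommutativeRing _≡_ _+_ _*_ -_ 0# 1#
    0≢1     : ¬ (0# ≡ 1#)
    _⁻¹     : Op₁ Carrier            -- value at 0# is irrelevant
    ⁻¹-inverse : ∀ x → ¬ (x ≡ 0#) → x * (x ⁻¹) ≡ 1#
    q       : ℕ
    enumeration : Carrier ↔ Fin q

module FieldOps (F : FiniteField) where
  open FiniteField F public

  ΣF : ∀ {n} → (Fin n → Carrier) → Carrier
  ΣF {zero}  f = 0#
  ΣF {suc n} f = f zero + ΣF (λ i → f (suc i))

  ΠF : ∀ {n} → (Fin n → Carrier) → Carrier
  ΠF {zero}  f = 1#
  ΠF {suc n} f = f zero * ΠF (λ i → f (suc i))

  Vec : ℕ → Set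
  Vec k = Fin k → Carrier

  lincomb : ∀ {m k} → (Fin m → Carrier) → (Fin m → Vec k) → Vec k
  lincomb c v j = ΣF (λ i → c i * v i j)

  zeroV : ∀ {k} → Vec k
  zeroV _ = 0#

  LinearlyIndependent : ∀ {m k} → (Fin m → Vec k) → Set
  LinearlyIndependent v = ∀ c → lincomb c v ≡ zeroV → ∀ i → c i ≡ 0#

  Spans : ∀ {m k} → (Fin m → Vec k) → Set
  Spans {k = k} v = ∀ (w : Vec k) → ∃ λ c → lincomb c v ≡ w

  IsBasis : ∀ {k} → (Fin k → Vec k) → Set
  IsBasis v = LinearlyIndependent v × Spans v

  -- a (indexed) set of m vectors is an arc if its elements are distinct
  -- and every k-subset (= injective choice of k indices) is a basis
  Injective : ∀ {a b} {A : Set a} {B : Set b} → (A → B) → Set _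
  Injective f = ∀ {x y} → f x ≡ f y → x ≡ y

  IsArc : ∀ {m k} → (Fin m → Vec k) → Set
  IsArc {m} {k} S = Injective S × (∀ (ι : Fin k → Fin m) → Injective ι → IsBasis (λ i → S (ι i)))

  removeAt : ∀ {n} {A : Set} → Fin (suc n) → (Fin (suc n) → A) → Fin n → A
  removeAt zero    f i       = f (suc i)
  removeAt (suc j) f zero    = f zero
  removeAt {suc n} (suc j) f (suc i) = removeAt j (λ x → f (suc x)) i

  altΣ : ∀ {n} → (Fin n → Carrier) → Carrier
  altΣ {zero}  f = 0#
  altΣ {suc n} f = f zero + - altΣ (λ i → f (suc i))

  det : ∀ {n} → (Fin n → Vec n) → Carrier
  det {zero}  M = 1#
  det {suc n} M = altΣ (λ j → M zero j * det (λ i → removeAt j (M (suc i))))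

  -- linear forms, given by their coefficients w.r.t. the dual basis
  Form : ℕ → Set
  Form k = Fin k → Carrier

  eval : ∀ {k} → Form k → Vec k → Carrier
  eval α x = ΣF (λ j → α j * x j)

  PairwiseLinearlyIndependent : ∀ {t k} → (Fin t → Form k) → Set
  PairwiseLinearlyIndependent {t} α =
    ∀ (i j : Fin t) → ¬ (i ≡ j) → ∀ (λ₁ λ₂ : Carrier) →
      (∀ x → λ₁ * α i x + λ₂ * α j x ≡ 0#) → (λ₁ ≡ 0#) × (λ₂ ≡ 0#)

  StrictlyIncreasing : ∀ {n m} → (Fin n → Fin m) → Set
  StrictlyIncreasing a = ∀ i j → i < j → a i < a j

  -- membership of an index of S in A = {S (a 1), ..., S (a n)}
  inA : ∀ {n m} → (Fin n → Fin m) → Fin m → Bool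
  inA a s = ⌊ any? (λ j → a j ≟ᶠ s) ⌋

  inSub : ∀ {m} → Subset m → Fin m → Bool
  inSub E s = ⌊ s ∈? E ⌋

  -- d_A(u,v) = det(u, v, a_1, ..., a_{k-2}),  k = 2 + n
  dA : ∀ {n m} → (Fin m → Vec (suc (suc n))) → (Fin n → Fin m)
     → Vec (suc (suc n)) → Vec (suc (suc n)) → Carrier
  dA {n} S a u v = det rows
    where
    rows : Fin (suc (suc n)) → Vec (suc (suc n))
    rows zero = u
    rows (suc zero) = v
    rows (suc (suc i)) = S (a i)

  fA : ∀ {t k} → (Fin t → Form k) → Vec k → Carrier
  fA α x = ΠF (λ i → eval (α i) x)

  identitySum : ∀ {n m t} → (Fin m → Vec (suc (suc n))) → (Fin n → Fin m)
              → (Fin t → Form (suc (suc n))) → Subset m → Carrier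
  identitySum S a α E =
    ΣF (λ e → if inSub E e ∧ not (inA a e)
              then fA α (S e) *
                   ΠF (λ u → if inSub E u ∧ not (inA a u) ∧ not ⌊ u ≟ᶠ e ⌋
                             then dA S a (S u) (S e) ⁻¹
                             else 1#)
              else 0#)

module Submission where

-- For a set P of points of the arc outside A let Λ_P(g) = Σ_{e ∈ P} g(e) Π_{u ∈ P∖{e}} d_A(u,e)⁻¹.
-- Multiplying g by d_A(p,·) for some p ∈ P kills the summand at p and cancels the factor u = p
-- everywhere else, so Λ_P(d_A(p,·) h) = Λ_{P∖{p}}(h).  Since every k-subset of the arc is a basis,
-- a linear form α vanishing on A interpolates on any two points u ≠ v of P as
--   α(x) = α(v) d_A(u,v)⁻¹ d_A(u,x) + α(u) d_A(v,u)⁻¹ d_A(v,x),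
-- so each factor α_i of f_A can be traded for a point of E∖A.  After t steps only sums over two
-- points with g = 1 remain, and these vanish because d_A is antisymmetric.

open import Defs
open import Level using (0ℓ)
open import Algebra.Bundles using (CommutativeRing)
open import Data.Nat using (ℕ; zero; suc)
import Data.Nat as ℕ
import Data.Nat.Properties as ℕ
open import Data.Fin as Fin using (Fin; zero; suc; punchIn; punchOut; inject₁; toℕ; fromℕ<)
open import Data.Fin.Properties
  using ( punchInᵢ≢i; punchOut-injective; suc-injective; toℕ-injective; toℕ-fromℕ<; toℕ<n
        ; <⇒≢; <-cmp; <-irrefl; pigeonhole; any?; _≟_ )
import Data.Fin.Permutation as Permutation
open import Data.Fin.Permutation.Components using (transpose)
open import Data.Bool using (Bool; true; false; if_then_else_; _∧_; _∨_; not)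
open import Data.Bool.Properties using (∧-zeroʳ; ∧-identityʳ; ∧-assoc)
open import Data.Product using (∃; ∃₂; _×_; _,_; proj₂)
open import Data.Sum using (_⊎_; inj₁; inj₂)
open import Data.Fin.Subset using (Subset; _∈_; ∣_∣)
open import Data.Fin.Subset.Properties using (_∈?_)
open import Data.Vec using ([]; _∷_)
open import Data.Empty using (⊥-elim)
open import Function using (_∘_; case_of_)
open import Relation.Nullary using (¬_; yes; no; does)
open import Relation.Nullary.Decidable using (dec-true; dec-false; isYes≗does)
open import Relation.Binary.PropositionalEquality
open import Relation.Binary.Definitions using (tri<; tri≈; tri>)
open import Function.Bundles using (Equivalence)

_[_]≔_ : ∀ {n} {X : Set} → (Fin n → X) → Fin n → X → Fin n → X
(f [ r ]≔ x) i with i ≟ r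
... | yes _ = x
... | no  _ = f i

[]≔-updates : ∀ {n} {X : Set} (f : Fin n → X) r x → (f [ r ]≔ x) r ≡ x
[]≔-updates f r x with r ≟ r
... | yes _   = refl
... | no  r≢r = ⊥-elim (r≢r refl)

[]≔-minimal : ∀ {n} {X : Set} (f : Fin n → X) r x {i} → i ≢ r → (f [ r ]≔ x) i ≡ f i
[]≔-minimal f r x {i} i≢r with i ≟ r
... | yes i≡r = ⊥-elim (i≢r i≡r)
... | no  _   = refl

module Counting where
  open ≡-Reasoning

  count : ∀ {m} → (Fin m → Bool) → ℕ
  count {zero}  P = 0
  count {suc m} P = (if P zero then 1 else 0) ℕ.+ count (P ∘ suc)

  _∖_ : ∀ {m} → (Fin m → Bool) → Fin m → Fin m → Bool
  (P ∖ p) u = P u ∧ not (does (u ≟ p))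

  ∖-self : ∀ {m} (P : Fin m → Bool) p → (P ∖ p) p ≡ false
  ∖-self P p rewrite dec-true (p ≟ p) refl = ∧-zeroʳ (P p)

  ∖-other : ∀ {m} (P : Fin m → Bool) p {u} → u ≢ p → (P ∖ p) u ≡ P u
  ∖-other P p {u} u≢p rewrite dec-false (u ≟ p) u≢p = ∧-identityʳ (P u)

  ∖-⊆ : ∀ {m} (P : Fin m → Bool) p {u} → (P ∖ p) u ≡ true → P u ≡ true
  ∖-⊆ P p {u} with P u
  ... | true  = λ _ → refl
  ... | false = λ ()

  ∖-≢ : ∀ {m} (P : Fin m → Bool) p {u} → (P ∖ p) u ≡ true → u ≢ p
  ∖-≢ P p P∖pᵤ refl with trans (sym P∖pᵤ) (∖-self P p)
  ... | ()

  count-cong : ∀ {m} {P Q : Fin m → Bool} → (∀ u → P u ≡ Q u) → count P ≡ count Q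
  count-cong {zero}  P≗Q = refl
  count-cong {suc m} P≗Q = cong₂ (λ b c → (if b then 1 else 0) ℕ.+ c) (P≗Q zero) (count-cong (P≗Q ∘ suc))

  count-∖ : ∀ {m} (P : Fin m → Bool) p → P p ≡ true → count P ≡ suc (count (P ∖ p))
  count-∖ {suc m} P zero    Pp rewrite Pp = cong suc (count-cong (λ u → sym (∧-identityʳ (P (suc u)))))
  count-∖ {suc m} P (suc p) Pp = begin
    b ℕ.+ count (P ∘ suc)             ≡⟨ cong (b ℕ.+_) (count-∖ (P ∘ suc) p Pp) ⟩
    b ℕ.+ suc (count ((P ∘ suc) ∖ p))   ≡⟨ ℕ.+-suc b _ ⟩
    suc (b ℕ.+ count ((P ∘ suc) ∖ p))
      ≡⟨ cong (λ x → suc ((if x then 1 else 0) ℕ.+ count ((P ∘ suc) ∖ p))) (sym (∧-identityʳ (P zero))) ⟩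
    suc (count (P ∖ suc p))         ∎
    where b = if P zero then 1 else 0

  count-nonempty : ∀ {m} (P : Fin m → Bool) {k} → count P ≡ suc k → ∃ λ p → P p ≡ true
  count-nonempty {suc m} P count≡ with P zero in P₀
  ... | true  = zero , P₀
  ... | false = let p , Pp = count-nonempty (P ∘ suc) count≡ in suc p , Pp

  count-zero : ∀ {m} (P : Fin m → Bool) → count P ≡ 0 → ∀ u → P u ≡ false
  count-zero {suc m} P count≡0 zero    with P zero | count≡0
  ... | false | _ = refl
  count-zero {suc m} P count≡0 (suc u) = count-zero (P ∘ suc) (ℕ.m+n≡0⇒n≡0 (if P zero then 1 else 0) count≡0) u

  count-∖-pred : ∀ {m} (P : Fin m → Bool) {p k} → P p ≡ true → count P ≡ suc k → count (P ∖ p) ≡ k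
  count-∖-pred P {p} Pp count≡ = ℕ.suc-injective (trans (sym (count-∖ P p Pp)) count≡)

  two-elements : ∀ {m} (P : Fin m → Bool) {k} → count P ≡ suc (suc k) → ∃₂ λ p p′ → P p ≡ true × (P ∖ p) p′ ≡ true
  two-elements P count≡ with count-nonempty P count≡
  ... | p , Pp with count-nonempty (P ∖ p) (count-∖-pred P Pp count≡)
  ...   | p′ , P∖pₚ′ = p , p′ , Pp , P∖pₚ′

  count≡2⇒either : ∀ {m} (P : Fin m → Bool) {p p′} → count P ≡ 2 → P p ≡ true → (P ∖ p) p′ ≡ true →
              ∀ x → P x ≡ true → x ≡ p ⊎ x ≡ p′
  count≡2⇒either P {p} {p′} count≡2 Pp P∖pₚ′ x Px with x ≟ p | x ≟ p′
  ... | yes x≡p | _        = inj₁ x≡p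
  ... | no  _   | yes x≡p′ = inj₂ x≡p′
  ... | no  x≢p | no  x≢p′ = ⊥-elim (true≢false (begin
    true                ≡⟨ sym Px ⟩
    P x                 ≡⟨ sym (∖-other P p x≢p) ⟩
    (P ∖ p) x           ≡⟨ sym (∖-other (P ∖ p) p′ x≢p′) ⟩
    ((P ∖ p) ∖ p′) x    ≡⟨ count-zero ((P ∖ p) ∖ p′) empty x ⟩
    false               ∎))
    where
    empty : count ((P ∖ p) ∖ p′) ≡ 0
    empty = count-∖-pred (P ∖ p) P∖pₚ′ (count-∖-pred P Pp count≡2)
    true≢false : true ≢ false
    true≢false ()

  count-image : ∀ {m n} (a : Fin n → Fin m) → (∀ {i j} → a i ≡ a j → i ≡ j) → (Q : Fin m → Bool) →
    (∀ j → Q (a j) ≡ true) → count (λ u → Q u ∧ not (does (any? (λ j → a j ≟ u)))) ℕ.+ n ≡ count Q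
  count-image {n = zero}  a _ Q _ = trans (ℕ.+-identityʳ _) (count-cong (λ u → ∧-identityʳ (Q u)))
  count-image {n = suc n} a a-injective Q Q-a = begin
    count (λ u → Q u ∧ not (does (a zero ≟ u) ∨ inTail u)) ℕ.+ suc n  ≡⟨ ℕ.+-suc _ n ⟩
    suc (count (λ u → Q u ∧ not (does (a zero ≟ u) ∨ inTail u)) ℕ.+ n)
      ≡⟨ cong (λ k → suc (k ℕ.+ n)) (count-cong (λ u → ∧-not-∨ (Q u) (does (a zero ≟ u)) (inTail u))) ⟩
    suc (count (λ u → (Q u ∧ not (does (a zero ≟ u))) ∧ not (inTail u)) ℕ.+ n)
      ≡⟨ cong (λ k → suc (k ℕ.+ n)) (count-cong (λ u → cong (λ b → (Q u ∧ not b) ∧ not (inTail u)) (does-sym (a zero) u))) ⟩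
    suc (count (λ u → (Q ∖ a zero) u ∧ not (inTail u)) ℕ.+ n)
      ≡⟨ cong suc (count-image (a ∘ suc) (suc-injective ∘ a-injective) (Q ∖ a zero) Q∖a₀-tail) ⟩
    suc (count (Q ∖ a zero))                                          ≡⟨ sym (count-∖ Q (a zero) (Q-a zero)) ⟩
    count Q                                                           ∎
    where
    inTail : Fin _ → Bool
    inTail u = does (any? (λ j → a (suc j) ≟ u))
    ∧-not-∨ : ∀ x y z → x ∧ not (y ∨ z) ≡ (x ∧ not y) ∧ not z
    ∧-not-∨ false _     _ = refl
    ∧-not-∨ true  false _ = refl
    ∧-not-∨ true  true  _ = refl
    does-sym : ∀ {m} (x y : Fin m) → does (x ≟ y) ≡ does (y ≟ x)
    does-sym x y with x ≟ y
    ... | yes refl = sym (dec-true (x ≟ x) refl)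
    ... | no  x≢y  = sym (dec-false (y ≟ x) (x≢y ∘ sym))
    Q∖a₀-tail : ∀ j → (Q ∖ a zero) (a (suc j)) ≡ true
    Q∖a₀-tail j = trans (∖-other Q (a zero) (λ eq → 0≢suc (a-injective (sym eq)))) (Q-a (suc j))
      where
      0≢suc : zero ≢ suc j
      0≢suc ()

  count-∈ : ∀ {m} (E : Subset m) → count (λ u → does (u ∈? E)) ≡ ∣ E ∣
  count-∈ []          = refl
  count-∈ (true  ∷ E) = cong suc (count-∈ E)
  count-∈ (false ∷ E) = count-∈ E

module FieldProperties (F : FiniteField) where
  open FieldOps F

  commutativeRing : CommutativeRing 0ℓ 0ℓ
  commutativeRing = record { isCommutativeRing = isCommutativeRing }

  open CommutativeRing commutativeRing public
    using ( +-identityˡ; +-identityʳ; +-comm; +-assoc; -‿inverseʳ; -‿inverseˡ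
          ; *-identityˡ; *-identityʳ; *-comm; *-assoc; zeroˡ; zeroʳ; distribˡ; distribʳ )
  open import Algebra.Properties.Ring (CommutativeRing.ring commutativeRing) public
    using (-0#≈0#; -‿involutive; -‿+-comm; +-inverseʳ-unique; -‿distribˡ-*; -‿distribʳ-*; -1*x≈-x; -‿anti-homo-+; xyx⁻¹≈y)
  open import Algebra.Properties.Semiring.Sum (CommutativeRing.semiring commutativeRing) public
    using (sum; sum-remove; ∑-distrib-+; ∑-comm; *-distribˡ-sum)
  open import Algebra.Properties.CommutativeMonoid.Sum (CommutativeRing.*-commutativeMonoid commutativeRing) public
    using ()
    renaming (sum to product; sum-remove to product-remove)
  open import Algebra.Properties.CommutativeSemigroup (CommutativeRing.+-commutativeSemigroup commutativeRing) public
    using () renaming (interchange to +-interchange)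
  open import Algebra.Properties.CommutativeSemigroup (CommutativeRing.*-commutativeSemigroup commutativeRing) public
    using () renaming (x∙yz≈y∙xz to *-leftComm; xy∙z≈zy∙x to *-swapOuter; interchange to *-interchange)
  open ≡-Reasoning

  -‿zero : ∀ {x} → - x ≡ 0# → x ≡ 0#
  -‿zero {x} h = trans (sym (-‿involutive x)) (trans (cong -_ h) -0#≈0#)

  x*y*[x⁻¹*z]≡y*z : ∀ {x} y z → x ≢ 0# → (x * y) * (x ⁻¹ * z) ≡ y * z
  x*y*[x⁻¹*z]≡y*z {x} y z x≢0 = begin
    (x * y) * (x ⁻¹ * z)  ≡⟨ *-interchange x y (x ⁻¹) z ⟩
    (x * x ⁻¹) * (y * z)  ≡⟨ cong (_* (y * z)) (⁻¹-inverse x x≢0) ⟩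
    1# * (y * z)          ≡⟨ *-identityˡ _ ⟩
    y * z                 ∎

  x-[x-y]≡y : ∀ x y → x + - (x + - y) ≡ y
  x-[x-y]≡y x y = begin
    x + - (x + - y)  ≡⟨ cong (x +_) (-‿anti-homo-+ x (- y)) ⟩
    x + (- - y + - x) ≡⟨ cong (λ z → x + (z + - x)) (-‿involutive y) ⟩
    x + (y + - x)    ≡⟨ sym (+-assoc x y (- x)) ⟩
    x + y + - x      ≡⟨ xyx⁻¹≈y x y ⟩
    y                ∎

  *-⁻¹-solve : ∀ {x y d} → d ≢ 0# → x * d ≡ y → x ≡ y * d ⁻¹
  *-⁻¹-solve {x} {y} {d} d≢0 x*d≡y = begin
    x                ≡⟨ sym (*-identityʳ x) ⟩
    x * 1#           ≡⟨ cong (x *_) (sym (⁻¹-inverse d d≢0)) ⟩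
    x * (d * d ⁻¹)   ≡⟨ sym (*-assoc x d _) ⟩
    (x * d) * d ⁻¹   ≡⟨ cong (_* d ⁻¹) x*d≡y ⟩
    y * d ⁻¹         ∎

  ΣF≡sum : ∀ {n} (f : Fin n → Carrier) → ΣF f ≡ sum f
  ΣF≡sum {zero}  f = refl
  ΣF≡sum {suc n} f = cong (f zero +_) (ΣF≡sum (f ∘ suc))

  ΠF≡product : ∀ {n} (f : Fin n → Carrier) → ΠF f ≡ product f
  ΠF≡product {zero}  f = refl
  ΠF≡product {suc n} f = cong (f zero *_) (ΠF≡product (f ∘ suc))

  ΣF-cong : ∀ {n} {f g : Fin n → Carrier} → (∀ i → f i ≡ g i) → ΣF f ≡ ΣF g
  ΣF-cong {zero}  h = refl
  ΣF-cong {suc n} h = cong₂ _+_ (h zero) (ΣF-cong (h ∘ suc))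

  ΠF-cong : ∀ {n} {f g : Fin n → Carrier} → (∀ i → f i ≡ g i) → ΠF f ≡ ΠF g
  ΠF-cong {zero}  h = refl
  ΠF-cong {suc n} h = cong₂ _*_ (h zero) (ΠF-cong (h ∘ suc))

  ΣF-zero : ∀ {n} (f : Fin n → Carrier) → (∀ i → f i ≡ 0#) → ΣF f ≡ 0#
  ΣF-zero {zero}  f h = refl
  ΣF-zero {suc n} f h = trans (cong₂ _+_ (h zero) (ΣF-zero (f ∘ suc) (h ∘ suc))) (+-identityˡ 0#)

  ΠF-one : ∀ {n} (f : Fin n → Carrier) → (∀ i → f i ≡ 1#) → ΠF f ≡ 1#
  ΠF-one {zero}  f h = refl
  ΠF-one {suc n} f h = trans (cong₂ _*_ (h zero) (ΠF-one (f ∘ suc) (h ∘ suc))) (*-identityˡ 1#)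

  ΣF-remove : ∀ {n} (f : Fin (suc n) → Carrier) p → ΣF f ≡ f p + ΣF (f ∘ punchIn p)
  ΣF-remove f p = begin
    ΣF f                      ≡⟨ ΣF≡sum f ⟩
    sum f                     ≡⟨ sum-remove {i = p} f ⟩
    f p + sum (f ∘ punchIn p) ≡⟨ cong (f p +_) (sym (ΣF≡sum (f ∘ punchIn p))) ⟩
    f p + ΣF (f ∘ punchIn p)  ∎

  ΠF-remove : ∀ {n} (f : Fin (suc n) → Carrier) p → ΠF f ≡ f p * ΠF (f ∘ punchIn p)
  ΠF-remove f p = begin
    ΠF f                          ≡⟨ ΠF≡product f ⟩
    product f                     ≡⟨ product-remove {i = p} f ⟩
    f p * product (f ∘ punchIn p) ≡⟨ cong (f p *_) (sym (ΠF≡product (f ∘ punchIn p))) ⟩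
    f p * ΠF (f ∘ punchIn p)      ∎

  ΠF-extract : ∀ {n} (f : Fin n → Carrier) p → ΠF f ≡ f p * ΠF (f [ p ]≔ 1#)
  ΠF-extract {suc n} f p = begin
    ΠF f                               ≡⟨ ΠF-remove f p ⟩
    f p * ΠF (f ∘ punchIn p)           ≡⟨ cong (f p *_) (ΠF-cong (λ u → sym ([]≔-minimal f p 1# (punchInᵢ≢i p u)))) ⟩
    f p * ΠF ((f [ p ]≔ 1#) ∘ punchIn p) ≡⟨ cong (f p *_) (sym (*-identityˡ _)) ⟩
    f p * (1# * ΠF ((f [ p ]≔ 1#) ∘ punchIn p))
      ≡⟨ cong (λ z → f p * (z * ΠF ((f [ p ]≔ 1#) ∘ punchIn p))) (sym ([]≔-updates f p 1#)) ⟩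
    f p * ((f [ p ]≔ 1#) p * ΠF ((f [ p ]≔ 1#) ∘ punchIn p)) ≡⟨ cong (f p *_) (sym (ΠF-remove (f [ p ]≔ 1#) p)) ⟩
    f p * ΠF (f [ p ]≔ 1#)             ∎

  ΣF-single : ∀ {n} (f : Fin n → Carrier) p → (∀ u → u ≢ p → f u ≡ 0#) → ΣF f ≡ f p
  ΣF-single {suc _} f p h = begin
    ΣF f                      ≡⟨ ΣF-remove f p ⟩
    f p + ΣF (f ∘ punchIn p)  ≡⟨ cong (f p +_) (ΣF-zero _ (λ u → h _ (punchInᵢ≢i p u))) ⟩
    f p + 0#                  ≡⟨ +-identityʳ _ ⟩
    f p                       ∎

  ΣF-+ : ∀ {n} (f g : Fin n → Carrier) → ΣF (λ i → f i + g i) ≡ ΣF f + ΣF g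
  ΣF-+ f g = begin
    ΣF (λ i → f i + g i)   ≡⟨ ΣF≡sum (λ i → f i + g i) ⟩
    sum (λ i → f i + g i)  ≡⟨ ∑-distrib-+ f g ⟩
    sum f + sum g          ≡⟨ sym (cong₂ _+_ (ΣF≡sum f) (ΣF≡sum g)) ⟩
    ΣF f + ΣF g            ∎

  ΣF-*ˡ : ∀ {n} (c : Carrier) (f : Fin n → Carrier) → ΣF (λ i → c * f i) ≡ c * ΣF f
  ΣF-*ˡ c f = begin
    ΣF (λ i → c * f i)   ≡⟨ ΣF≡sum (λ i → c * f i) ⟩
    sum (λ i → c * f i)  ≡⟨ sym (*-distribˡ-sum c f) ⟩
    c * sum f            ≡⟨ cong (c *_) (sym (ΣF≡sum f)) ⟩
    c * ΣF f             ∎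

  ΣF-linear : ∀ {n} (c d : Carrier) (f g : Fin n → Carrier) →
              ΣF (λ i → c * f i + d * g i) ≡ c * ΣF f + d * ΣF g
  ΣF-linear c d f g = trans (ΣF-+ (λ i → c * f i) (λ i → d * g i)) (cong₂ _+_ (ΣF-*ˡ c f) (ΣF-*ˡ d g))

  ΣF-comm : ∀ {m n} (f : Fin m → Fin n → Carrier) → ΣF (λ i → ΣF (f i)) ≡ ΣF (λ j → ΣF (λ i → f i j))
  ΣF-comm f = begin
    ΣF (λ i → ΣF (f i))            ≡⟨ trans (ΣF-cong (λ i → ΣF≡sum (f i))) (ΣF≡sum (λ i → sum (f i))) ⟩
    sum (λ i → sum (f i))          ≡⟨ ∑-comm f ⟩
    sum (λ j → sum (λ i → f i j))
      ≡⟨ sym (trans (ΣF-cong (λ j → ΣF≡sum (λ i → f i j))) (ΣF≡sum (λ j → sum (λ i → f i j)))) ⟩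
    ΣF (λ j → ΣF (λ i → f i j))    ∎

  altΣ-cong : ∀ {n} {f g : Fin n → Carrier} → (∀ i → f i ≡ g i) → altΣ f ≡ altΣ g
  altΣ-cong {zero}  h = refl
  altΣ-cong {suc n} h = cong₂ (λ x y → x + - y) (h zero) (altΣ-cong (h ∘ suc))

  altΣ-zero : ∀ {n} (f : Fin n → Carrier) → (∀ i → f i ≡ 0#) → altΣ f ≡ 0#
  altΣ-zero {zero}  f h = refl
  altΣ-zero {suc n} f h = begin
    f zero + - altΣ (f ∘ suc)  ≡⟨ cong₂ (λ x y → x + - y) (h zero) (altΣ-zero (f ∘ suc) (h ∘ suc)) ⟩
    0# + - 0#                  ≡⟨ -‿inverseʳ 0# ⟩
    0#                         ∎

  altΣ-linear : ∀ {n} (c : Carrier) (f g : Fin n → Carrier) →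
                altΣ (λ i → c * f i + g i) ≡ c * altΣ f + altΣ g
  altΣ-linear {zero}  c f g = sym (trans (+-identityʳ _) (zeroʳ c))
  altΣ-linear {suc n} c f g = begin
    (c * f zero + g zero) + - altΣ (λ i → c * f (suc i) + g (suc i))
      ≡⟨ cong (λ x → (c * f zero + g zero) + - x) (altΣ-linear c (f ∘ suc) (g ∘ suc)) ⟩
    (c * f zero + g zero) + - (c * altΣ (f ∘ suc) + altΣ (g ∘ suc))
      ≡⟨ cong ((c * f zero + g zero) +_) (sym (-‿+-comm _ _)) ⟩
    (c * f zero + g zero) + (- (c * altΣ (f ∘ suc)) + - altΣ (g ∘ suc))
      ≡⟨ cong (λ z → (c * f zero + g zero) + (z + - altΣ (g ∘ suc))) (-‿distribʳ-* c _) ⟩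
    (c * f zero + g zero) + (c * - altΣ (f ∘ suc) + - altΣ (g ∘ suc))
      ≡⟨ +-interchange _ _ _ _ ⟩
    (c * f zero + c * - altΣ (f ∘ suc)) + (g zero + - altΣ (g ∘ suc))
      ≡⟨ cong (_+ altΣ g) (sym (distribˡ c _ _)) ⟩
    c * altΣ f + altΣ g ∎

  altΣ-neg : ∀ {n} (f : Fin n → Carrier) → altΣ (λ i → - f i) ≡ - altΣ f
  altΣ-neg {zero}  f = sym -0#≈0#
  altΣ-neg {suc n} f = begin
    - f zero + - altΣ (λ i → - f (suc i))  ≡⟨ cong (λ x → - f zero + - x) (altΣ-neg (f ∘ suc)) ⟩
    - f zero + - - altΣ (f ∘ suc)          ≡⟨ -‿+-comm _ _ ⟩
    - altΣ f                               ∎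

  ⁻¹-neg : ∀ x → x ≢ 0# → (- x) ⁻¹ ≡ - (x ⁻¹)
  ⁻¹-neg x x≢0 = sym (begin
    - (x ⁻¹)                    ≡⟨ cong -_ (sym (*-identityʳ _)) ⟩
    - (x ⁻¹ * 1#)               ≡⟨ cong (λ z → - (x ⁻¹ * z)) (sym (⁻¹-inverse (- x) (x≢0 ∘ -‿zero))) ⟩
    - (x ⁻¹ * (- x * (- x) ⁻¹)) ≡⟨ cong (λ z → - (x ⁻¹ * z)) (sym (-‿distribˡ-* x _)) ⟩
    - (x ⁻¹ * - (x * (- x) ⁻¹)) ≡⟨ cong -_ (sym (-‿distribʳ-* _ _)) ⟩
    - - (x ⁻¹ * (x * (- x) ⁻¹)) ≡⟨ -‿involutive _ ⟩
    x ⁻¹ * (x * (- x) ⁻¹)       ≡⟨ sym (*-assoc _ _ _) ⟩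
    (x ⁻¹ * x) * (- x) ⁻¹       ≡⟨ cong (_* (- x) ⁻¹) (trans (*-comm _ _) (⁻¹-inverse x x≢0)) ⟩
    1# * (- x) ⁻¹               ≡⟨ *-identityˡ _ ⟩
    (- x) ⁻¹                    ∎)

  alternating⇒antisymmetric : ∀ {X : Set} (_⊞_ : X → X → X) (B : X → X → Carrier) →
    (∀ x x′ y → B (x ⊞ x′) y ≡ B x y + B x′ y) → (∀ x y y′ → B x (y ⊞ y′) ≡ B x y + B x y′) →
    (∀ x → B x x ≡ 0#) → ∀ x y → B x y ≡ - B y x
  alternating⇒antisymmetric _⊞_ B additiveˡ additiveʳ alternating x y =
    +-inverseʳ-unique (B y x) (B x y) (begin
      B y x + B x y                          ≡⟨ +-comm _ _ ⟩
      B x y + B y x                          ≡⟨ sym (cong₂ _+_ (+-identityˡ _) (+-identityʳ _)) ⟩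
      (0# + B x y) + (B y x + 0#)
        ≡⟨ cong₂ (λ a d → (a + B x y) + (B y x + d)) (sym (alternating x)) (sym (alternating y)) ⟩
      (B x x + B x y) + (B y x + B y y)      ≡⟨ sym (cong₂ _+_ (additiveʳ x x y) (additiveʳ y x y)) ⟩
      B x (x ⊞ y) + B y (x ⊞ y)              ≡⟨ sym (additiveˡ x y (x ⊞ y)) ⟩
      B (x ⊞ y) (x ⊞ y)                      ≡⟨ alternating (x ⊞ y) ⟩
      0#                                     ∎)

module Determinant (F : FiniteField) where
  open FieldOps F
  open FieldProperties F
  open ≡-Reasoning

  Matrix : ℕ → Set
  Matrix n = Fin n → Vec n

  minor : ∀ {n} → Matrix (suc n) → Fin (suc n) → Matrix n
  minor M j i = removeAt j (M (suc i))

  removeAt-punchIn : ∀ {n} {X : Set} j (f : Fin (suc n) → X) i → removeAt j f i ≡ f (punchIn j i)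
  removeAt-punchIn zero    f i       = refl
  removeAt-punchIn (suc j) f zero    = refl
  removeAt-punchIn {suc n} (suc j) f (suc i) = removeAt-punchIn j (f ∘ suc) i

  removeAt-cong : ∀ {n} {X : Set} j {f g : Fin (suc n) → X} → f ≗ g → removeAt j f ≗ removeAt j g
  removeAt-cong j {f} {g} f≗g i = trans (removeAt-punchIn j f i) (trans (f≗g _) (sym (removeAt-punchIn j g i)))

  det-cong : ∀ {n} {M N : Matrix n} → (∀ i → M i ≗ N i) → det M ≡ det N
  det-cong {zero}  M≗N = refl
  det-cong {suc n} M≗N =
    altΣ-cong (λ j → cong₂ _*_ (M≗N zero j) (det-cong (λ i → removeAt-cong j (M≗N (suc i)))))

  det-expansion : ∀ {n} (M A B : Matrix (suc n)) c →
    (∀ j → M zero j * det (minor M j) ≡ c * (A zero j * det (minor A j)) + B zero j * det (minor B j)) →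
    det M ≡ c * det A + det B
  det-expansion M A B c h =
    trans (altΣ-cong h) (altΣ-linear c (λ j → A zero j * det (minor A j)) (λ j → B zero j * det (minor B j)))

  det-linear : ∀ {n} (M A B : Matrix n) r c → (∀ i → i ≢ r → M i ≗ A i) → (∀ i → i ≢ r → M i ≗ B i) →
    (∀ k → M r k ≡ c * A r k + B r k) → det M ≡ c * det A + det B
  det-linear {suc n} M A B zero c M≗A M≗B M₀ = det-expansion M A B c λ j → begin
    M zero j * det (minor M j)                   ≡⟨ cong (_* det (minor M j)) (M₀ j) ⟩
    (c * A zero j + B zero j) * det (minor M j)
      ≡⟨ trans (distribʳ _ _ _) (cong (_+ B zero j * det (minor M j)) (*-assoc _ _ _)) ⟩
    c * (A zero j * det (minor M j)) + B zero j * det (minor M j)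
      ≡⟨ cong₂ (λ x y → c * (A zero j * x) + B zero j * y)
               (det-cong (λ i → removeAt-cong j (M≗A (suc i) λ ())))
               (det-cong (λ i → removeAt-cong j (M≗B (suc i) λ ()))) ⟩
    c * (A zero j * det (minor A j)) + B zero j * det (minor B j) ∎
  det-linear {suc n} M A B (suc r) c M≗A M≗B Mᵣ = det-expansion M A B c λ j → begin
    M zero j * det (minor M j)                           ≡⟨ cong (M zero j *_) (minor-linear j) ⟩
    M zero j * (c * det (minor A j) + det (minor B j))
      ≡⟨ trans (distribˡ _ _ _) (cong (_+ M zero j * det (minor B j)) (*-leftComm _ _ _)) ⟩
    c * (M zero j * det (minor A j)) + M zero j * det (minor B j)
      ≡⟨ cong₂ (λ x y → c * (x * det (minor A j)) + y * det (minor B j)) (M≗A zero (λ ()) j) (M≗B zero (λ ()) j) ⟩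
    c * (A zero j * det (minor A j)) + B zero j * det (minor B j) ∎
    where
    minor-linear : ∀ j → det (minor M j) ≡ c * det (minor A j) + det (minor B j)
    minor-linear j = det-linear (minor M j) (minor A j) (minor B j) r c
      (λ i i≢r → removeAt-cong j (M≗A (suc i) (i≢r ∘ suc-injective)))
      (λ i i≢r → removeAt-cong j (M≗B (suc i) (i≢r ∘ suc-injective)))
      (λ k → begin
        removeAt j (M (suc r)) k                                 ≡⟨ removeAt-punchIn j (M (suc r)) k ⟩
        M (suc r) (punchIn j k)                                  ≡⟨ Mᵣ (punchIn j k) ⟩
        c * A (suc r) (punchIn j k) + B (suc r) (punchIn j k)
          ≡⟨ sym (cong₂ (λ x y → c * x + y) (removeAt-punchIn j (A (suc r)) k) (removeAt-punchIn j (B (suc r)) k)) ⟩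
        c * removeAt j (A (suc r)) k + removeAt j (B (suc r)) k  ∎)

  det-additive : ∀ {n} (M A B : Matrix n) r → (∀ i → i ≢ r → M i ≗ A i) → (∀ i → i ≢ r → M i ≗ B i) →
    (∀ k → M r k ≡ A r k + B r k) → det M ≡ det A + det B
  det-additive M A B r M≗A M≗B Mᵣ = begin
    det M              ≡⟨ det-linear M A B r 1# M≗A M≗B (λ k → trans (Mᵣ k) (cong (_+ B r k) (sym (*-identityˡ _)))) ⟩
    1# * det A + det B ≡⟨ cong (_+ det B) (*-identityˡ _) ⟩
    det A + det B      ∎

  det-zeroRow : ∀ {n} (M : Matrix n) r → (∀ k → M r k ≡ 0#) → det M ≡ 0#
  det-zeroRow M r Mᵣ = begin
    det M                 ≡⟨ det-linear M M M r (- 1#) (λ _ _ _ → refl) (λ _ _ _ → refl) row ⟩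
    - 1# * det M + det M  ≡⟨ cong (_+ det M) (-1*x≈-x (det M)) ⟩
    - det M + det M       ≡⟨ -‿inverseˡ _ ⟩
    0#                    ∎
    where
    row : ∀ k → M r k ≡ - 1# * M r k + M r k
    row k = begin
      M r k                 ≡⟨ Mᵣ k ⟩
      0#                    ≡⟨ sym (trans (cong (_+ 0#) (zeroʳ (- 1#))) (+-identityʳ 0#)) ⟩
      - 1# * 0# + 0#        ≡⟨ sym (cong₂ (λ x y → - 1# * x + y) (Mᵣ k) (Mᵣ k)) ⟩
      - 1# * M r k + M r k  ∎

  det-linearCombination : ∀ {n m} (M : Matrix n) r (c : Fin m → Carrier) (N : Fin m → Matrix n) →
    (∀ j i → i ≢ r → N j i ≗ M i) → (∀ k → M r k ≡ ΣF (λ j → c j * N j r k)) →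
    det M ≡ ΣF (λ j → c j * det (N j))
  det-linearCombination {m = zero}  M r c N N≗M Mᵣ = det-zeroRow M r Mᵣ
  det-linearCombination {m = suc m} M r c N N≗M Mᵣ = begin
    det M                                              ≡⟨ det-linear M (N zero) M′ r (c zero) M≗N₀ M≗M′ Mᵣ′ ⟩
    c zero * det (N zero) + det M′                     ≡⟨ cong (c zero * det (N zero) +_) M′-expansion ⟩
    c zero * det (N zero) + ΣF (λ j → c (suc j) * det (N (suc j))) ∎
    where
    rest : Vec _
    rest k = ΣF (λ j → c (suc j) * N (suc j) r k)
    M′ : Matrix _
    M′ = M [ r ]≔ rest
    M≗N₀ : ∀ i → i ≢ r → M i ≗ N zero i
    M≗N₀ i i≢r k = sym (N≗M zero i i≢r k)
    M≗M′ : ∀ i → i ≢ r → M i ≗ M′ i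
    M≗M′ i i≢r k = cong (λ v → v k) (sym ([]≔-minimal M r rest i≢r))
    Mᵣ′ : ∀ k → M r k ≡ c zero * N zero r k + M′ r k
    Mᵣ′ k = trans (Mᵣ k) (cong (λ v → c zero * N zero r k + v k) (sym ([]≔-updates M r rest)))
    M′-expansion : det M′ ≡ ΣF (λ j → c (suc j) * det (N (suc j)))
    M′-expansion = det-linearCombination M′ r (c ∘ suc) (N ∘ suc)
      (λ j i i≢r k → trans (N≗M (suc j) i i≢r k) (M≗M′ i i≢r k))
      (λ k → cong (λ v → v k) ([]≔-updates M r rest))

  -- Expanding a determinant along two equal first rows r gives doubleExpansion r Q, where Q j j′ is
  -- the minor of the remaining rows with columns j and then j′ deleted; deleting the same two
  -- columns in the other order gives the same minor, which is ColumnSymmetric.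
  ColumnSymmetric : ∀ {w} → (Fin (suc (suc w)) → Fin (suc w) → Carrier) → Set
  ColumnSymmetric {w} Q = ∀ (j j′ : Fin (suc w)) → j′ Fin.≤ j → Q (suc j) j′ ≡ Q (inject₁ j′) j

  doubleExpansion : ∀ {w} → Vec (suc (suc w)) → (Fin (suc (suc w)) → Fin (suc w) → Carrier) → Carrier
  doubleExpansion r Q = altΣ (λ j → r j * altΣ (λ j′ → removeAt j r j′ * Q j j′))

  doubleExpansion-suc : ∀ {w} (r : Vec (suc (suc w))) Q → ColumnSymmetric Q →
    doubleExpansion r Q ≡ altΣ (λ j → r (suc j) * altΣ (λ j′ → removeAt j (r ∘ suc) j′ * Q (suc j) (suc j′)))
  doubleExpansion-suc r Q Q-sym = begin
    r zero * A + - altΣ (λ j → r (suc j) * (r zero * Q (suc j) zero + - Ψ j))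
      ≡⟨ cong (λ z → r zero * A + - z) (altΣ-cong rearrange) ⟩
    r zero * A + - altΣ (λ j → r zero * (r (suc j) * Q zero j) + - (r (suc j) * Ψ j))
      ≡⟨ cong (λ z → r zero * A + - z) (altΣ-linear (r zero) (λ j → r (suc j) * Q zero j) (λ j → - (r (suc j) * Ψ j))) ⟩
    r zero * A + - (r zero * A + altΣ (λ j → - (r (suc j) * Ψ j)))
      ≡⟨ cong (λ z → r zero * A + - (r zero * A + z)) (altΣ-neg (λ j → r (suc j) * Ψ j)) ⟩
    r zero * A + - (r zero * A + - altΣ (λ j → r (suc j) * Ψ j))
      ≡⟨ x-[x-y]≡y _ _ ⟩
    altΣ (λ j → r (suc j) * Ψ j) ∎
    where
    A = altΣ (λ j → r (suc j) * Q zero j)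
    Ψ : Fin _ → Carrier
    Ψ j = altΣ (λ j′ → removeAt j (r ∘ suc) j′ * Q (suc j) (suc j′))
    rearrange : ∀ j → r (suc j) * (r zero * Q (suc j) zero + - Ψ j) ≡ r zero * (r (suc j) * Q zero j) + - (r (suc j) * Ψ j)
    rearrange j = begin
      r (suc j) * (r zero * Q (suc j) zero + - Ψ j)
        ≡⟨ distribˡ _ _ _ ⟩
      r (suc j) * (r zero * Q (suc j) zero) + r (suc j) * - Ψ j
        ≡⟨ cong₂ _+_ (trans (*-leftComm _ _ _) (cong (λ z → r zero * (r (suc j) * z)) (Q-sym j zero ℕ.z≤n)))
                     (sym (-‿distribʳ-* _ _)) ⟩
      r zero * (r (suc j) * Q zero j) + - (r (suc j) * Ψ j) ∎

  doubleExpansion-zero : ∀ {w} (r : Vec (suc (suc w))) Q → ColumnSymmetric Q → doubleExpansion r Q ≡ 0#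
  doubleExpansion-zero {zero}  r Q Q-sym =
    trans (doubleExpansion-suc r Q Q-sym) (altΣ-zero (λ j → r (suc j) * 0#) (λ j → zeroʳ _))
  doubleExpansion-zero {suc w} r Q Q-sym = trans (doubleExpansion-suc r Q Q-sym)
    (doubleExpansion-zero (r ∘ suc) (λ j j′ → Q (suc j) (suc j′))
                          (λ j j′ j′≤j → Q-sym (suc j) (suc j′) (ℕ.s≤s j′≤j)))

  punchIn-comm : ∀ {n} (j j′ : Fin (suc n)) → j′ Fin.≤ j → ∀ i →
                 punchIn (suc j) (punchIn j′ i) ≡ punchIn (inject₁ j′) (punchIn j i)
  punchIn-comm j       zero     _              i       = refl
  punchIn-comm (suc j) (suc j′) _              zero    = refl
  punchIn-comm (suc j) (suc j′) (ℕ.s≤s j′≤j) (suc i) = cong suc (punchIn-comm j j′ j′≤j i)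

  det-equalRows₀₁ : ∀ {n} (M : Matrix (suc (suc n))) → M zero ≗ M (suc zero) → det M ≡ 0#
  det-equalRows₀₁ M M₀≗M₁ = begin
    det M                 ≡⟨ altΣ-cong (λ j → cong (M zero j *_) (altΣ-cong (λ j′ →
                               cong (_* Q j j′) (removeAt-cong j (sym ∘ M₀≗M₁) j′)))) ⟩
    doubleExpansion (M zero) Q ≡⟨ doubleExpansion-zero (M zero) Q Q-sym ⟩
    0#                    ∎
    where
    Q : Fin _ → Fin _ → Carrier
    Q j j′ = det (λ i → removeAt j′ (removeAt j (M (suc (suc i)))))
    Q-sym : ColumnSymmetric Q
    Q-sym j j′ j′≤j = det-cong λ i k → begin
      removeAt j′ (removeAt (suc j) (M (suc (suc i)))) k
        ≡⟨ trans (removeAt-punchIn j′ _ k) (removeAt-punchIn (suc j) (M (suc (suc i))) _) ⟩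
      M (suc (suc i)) (punchIn (suc j) (punchIn j′ k))
        ≡⟨ cong (M (suc (suc i))) (punchIn-comm j j′ j′≤j k) ⟩
      M (suc (suc i)) (punchIn (inject₁ j′) (punchIn j k))
        ≡⟨ sym (trans (removeAt-punchIn j _ k) (removeAt-punchIn (inject₁ j′) (M (suc (suc i))) _)) ⟩
      removeAt j (removeAt (inject₁ j′) (M (suc (suc i)))) k ∎

  transpose-at-i : ∀ {n} (i j : Fin n) → transpose i j i ≡ j
  transpose-at-i i j rewrite dec-true (i ≟ i) refl = refl

  transpose-at-j : ∀ {n} (i j : Fin n) → transpose i j j ≡ i
  transpose-at-j i j with j ≟ i
  ... | yes j≡i = j≡i
  ... | no  _   rewrite dec-true (j ≟ j) refl = refl

  transpose-fixes : ∀ {n} (i j k : Fin n) → k ≢ i → k ≢ j → transpose i j k ≡ k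
  transpose-fixes i j k k≢i k≢j rewrite dec-false (k ≟ i) k≢i | dec-false (k ≟ j) k≢j = refl

  by-cases : ∀ {n} (p q : Fin n) (P : Fin n → Set) → P p → P q → (∀ i → i ≢ p → i ≢ q → P i) → ∀ i → P i
  by-cases p q P Pp Pq P-elsewhere i with i ≟ p | i ≟ q
  ... | yes refl | _        = Pp
  ... | no  _    | yes refl = Pq
  ... | no  i≢p  | no  i≢q  = P-elsewhere i i≢p i≢q

  Alternating : ℕ → Set
  Alternating n = ∀ (M : Matrix n) i j → i ≢ j → M i ≗ M j → det M ≡ 0#

  det-transpose : ∀ {n} → Alternating n → ∀ (M : Matrix n) p q → p ≢ q → det (M ∘ transpose p q) ≡ - det M
  det-transpose alternating M p q p≢q = begin
    det (M ∘ transpose p q)  ≡⟨ det-cong (λ i → cong-app (sym (swapped i))) ⟩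
    B (M q) (M p)            ≡⟨ alternating⇒antisymmetric _⊞_ B additiveˡ additiveʳ B-alternating (M q) (M p) ⟩
    - B (M p) (M q)          ≡⟨ cong -_ (det-cong (λ i → cong-app (unchanged i))) ⟩
    - det M                  ∎
    where
    rows : Vec _ → Vec _ → Matrix _
    rows x y = (M [ p ]≔ x) [ q ]≔ y
    B : Vec _ → Vec _ → Carrier
    B x y = det (rows x y)
    _⊞_ : Vec _ → Vec _ → Vec _
    (x ⊞ y) k = x k + y k
    at-p : ∀ x y → rows x y p ≡ x
    at-p x y = trans ([]≔-minimal _ q y p≢q) ([]≔-updates M p x)
    at-q : ∀ x y → rows x y q ≡ y
    at-q x y = []≔-updates _ q y
    off-p : ∀ x x′ y i → i ≢ p → rows x y i ≡ rows x′ y i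
    off-p x x′ y i i≢p with i ≟ q
    ... | yes _ = refl
    ... | no  _ = trans ([]≔-minimal M p x i≢p) (sym ([]≔-minimal M p x′ i≢p))
    off-q : ∀ x y y′ i → i ≢ q → rows x y i ≡ rows x y′ i
    off-q x y y′ i i≢q = trans ([]≔-minimal _ q y i≢q) (sym ([]≔-minimal _ q y′ i≢q))
    elsewhere : ∀ x y i → i ≢ p → i ≢ q → rows x y i ≡ M i
    elsewhere x y i i≢p i≢q = trans ([]≔-minimal _ q y i≢q) ([]≔-minimal M p x i≢p)
    additiveˡ : ∀ x x′ y → B (x ⊞ x′) y ≡ B x y + B x′ y
    additiveˡ x x′ y = det-additive _ _ _ p
      (λ i i≢p → cong-app (off-p _ _ y i i≢p)) (λ i i≢p → cong-app (off-p _ _ y i i≢p))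
      (λ k → trans (cong-app (at-p _ y) k) (sym (cong₂ (λ u v → u k + v k) (at-p x y) (at-p x′ y))))
    additiveʳ : ∀ x y y′ → B x (y ⊞ y′) ≡ B x y + B x y′
    additiveʳ x y y′ = det-additive _ _ _ q
      (λ i i≢q → cong-app (off-q x _ _ i i≢q)) (λ i i≢q → cong-app (off-q x _ _ i i≢q))
      (λ k → trans (cong-app (at-q x _) k) (sym (cong₂ (λ u v → u k + v k) (at-q x y) (at-q x y′))))
    B-alternating : ∀ x → B x x ≡ 0#
    B-alternating x = alternating (rows x x) p q p≢q (λ k → trans (cong-app (at-p x x) k) (sym (cong-app (at-q x x) k)))
    swapped : ∀ i → rows (M q) (M p) i ≡ M (transpose p q i)
    swapped = by-cases p q (λ i → rows (M q) (M p) i ≡ M (transpose p q i))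
      (trans (at-p _ _) (cong M (sym (transpose-at-i p q))))
      (trans (at-q _ _) (cong M (sym (transpose-at-j p q))))
      (λ i i≢p i≢q → trans (elsewhere _ _ i i≢p i≢q) (cong M (sym (transpose-fixes p q i i≢p i≢q))))
    unchanged : ∀ i → rows (M p) (M q) i ≡ M i
    unchanged = by-cases p q (λ i → rows (M p) (M q) i ≡ M i) (at-p _ _) (at-q _ _) (elsewhere _ _)

  det-transpose-suc : ∀ {n} → Alternating n → ∀ (M : Matrix (suc n)) p q → p ≢ q →
    det (M ∘ transpose (suc p) (suc q)) ≡ - det M
  det-transpose-suc alternating M p q p≢q = begin
    altΣ (λ c → M zero c * det (minor (M ∘ transpose (suc p) (suc q)) c))
      ≡⟨ altΣ-cong (λ c → cong (M zero c *_) (trans (det-cong (λ i → cong-app (minor-transpose c i)))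
                                                     (det-transpose alternating (minor M c) p q p≢q))) ⟩
    altΣ (λ c → M zero c * - det (minor M c))   ≡⟨ altΣ-cong (λ c → sym (-‿distribʳ-* (M zero c) (det (minor M c)))) ⟩
    altΣ (λ c → - (M zero c * det (minor M c))) ≡⟨ altΣ-neg (λ c → M zero c * det (minor M c)) ⟩
    - det M                                     ∎
    where
    minor-transpose : ∀ c i → minor (M ∘ transpose (suc p) (suc q)) c i ≡ minor M c (transpose p q i)
    minor-transpose c i = cong (λ l → removeAt c (M l)) (Permutation.lift₀-transpose p q (suc i))

  det-equalRows₀ : ∀ {n} → Alternating n → ∀ (M : Matrix (suc n)) j → M zero ≗ M (suc j) → det M ≡ 0#
  det-equalRows₀ {suc n} alternating M zero    M₀≗M₁ = det-equalRows₀₁ M M₀≗M₁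
  det-equalRows₀ {suc n} alternating M (suc j) M₀≗Mⱼ = -‿zero (begin
    - det M                                        ≡⟨ sym (det-transpose-suc alternating M zero (suc j) (λ ())) ⟩
    det (M ∘ transpose (suc zero) (suc (suc j)))   ≡⟨ det-equalRows₀₁ (M ∘ transpose (suc zero) (suc (suc j))) M₀≗Mⱼ ⟩
    0#                                             ∎)

  alternating : ∀ n → Alternating n
  alternating (suc n) M zero    zero    0≢0 _   = ⊥-elim (0≢0 refl)
  alternating (suc n) M zero    (suc j) _   M≗M = det-equalRows₀ (alternating n) M j M≗M
  alternating (suc n) M (suc i) zero    _   M≗M = det-equalRows₀ (alternating n) M i (sym ∘ M≗M)
  alternating (suc n) M (suc i) (suc j) i≢j M≗M = altΣ-zero (λ c → M zero c * det (minor M c)) λ c →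
    trans (cong (M zero c *_) (alternating n (minor M c) i j (i≢j ∘ cong suc) (removeAt-cong c M≗M))) (zeroʳ _)

  identityMatrix : ∀ {n} → Matrix n
  identityMatrix zero    zero    = 1#
  identityMatrix zero    (suc _) = 0#
  identityMatrix (suc _) zero    = 0#
  identityMatrix (suc i) (suc j) = identityMatrix i j

  det-identity : ∀ n → det (identityMatrix {n}) ≡ 1#
  det-identity zero    = refl
  det-identity (suc n) = begin
    1# * det (identityMatrix {n}) + - altΣ off-diagonal
      ≡⟨ cong₂ (λ x y → x + - y) (trans (*-identityˡ _) (det-identity n)) (altΣ-zero off-diagonal (λ j → zeroˡ _)) ⟩
    1# + - 0#   ≡⟨ cong (1# +_) -0#≈0# ⟩
    1# + 0#     ≡⟨ +-identityʳ 1# ⟩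
    1#          ∎
    where
    off-diagonal : Fin n → Carrier
    off-diagonal j = 0# * det (minor (identityMatrix {suc n}) (suc j))

  collision : ∀ {N} (τ : Fin N → Fin N) p → (∀ l → τ l ≢ p) → ∃₂ λ i j → i ≢ j × τ i ≡ τ j
  collision {suc N} τ p τ≢p with pigeonhole (ℕ.n<1+n N) (λ l → punchOut (τ≢p l ∘ sym))
  ... | i , j , i<j , τᵢ≡τⱼ = i , j , <⇒≢ i<j , punchOut-injective (τ≢p i ∘ sym) (τ≢p j ∘ sym) τᵢ≡τⱼ

  above-position : ∀ {N d} (d<N : d ℕ.< N) l → d ℕ.≤ toℕ l → l ≢ fromℕ< d<N → suc d ℕ.≤ toℕ l
  above-position d<N l d≤l l≢p = ℕ.≤∧≢⇒< d≤l λ d≡l → l≢p (toℕ-injective (trans (sym d≡l) (sym (toℕ-fromℕ< d<N))))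

  beyond-range : ∀ {N d} → ¬ d ℕ.< N → ∀ (l : Fin N) → ¬ d ℕ.≤ toℕ l
  beyond-range d≮N l d≤l = d≮N (ℕ.≤-<-trans d≤l (toℕ<n l))

  module _ {N} (b : Matrix N) (det-b≡0 : det b ≡ 0#) where

    det-reindex-fixing : ∀ d (τ : Fin N → Fin N) → (∀ l → d ℕ.≤ toℕ l → τ l ≡ l) → det (b ∘ τ) ≡ 0#
    det-reindex-fixing zero    τ fixed = trans (det-cong (λ l k → cong (λ x → b x k) (fixed l ℕ.z≤n))) det-b≡0
    det-reindex-fixing (suc d) τ fixed with d ℕ.<? N
    ... | no  d≮N = det-reindex-fixing d τ (λ l d≤l → ⊥-elim (beyond-range d≮N l d≤l))
    ... | yes d<N with any? (λ q → τ q ≟ fromℕ< d<N)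
    ...   | no  τ≢p = let i , j , i≢j , τᵢ≡τⱼ = collision τ p (λ l τl≡p → τ≢p (l , τl≡p)) in
                      alternating N (b ∘ τ) i j i≢j (λ k → cong (λ x → b x k) τᵢ≡τⱼ)
      where p = fromℕ< d<N
    ...   | yes (q , τq≡p) with q ≟ fromℕ< d<N
    ...     | yes refl = det-reindex-fixing d τ λ l d≤l → case l ≟ p of λ where
                (yes refl) → τq≡p
                (no  l≢p)  → fixed l (above-position d<N l d≤l l≢p)
      where p = fromℕ< d<N
    ...     | no  q≢p  = -‿zero (begin
              - det (b ∘ τ)               ≡⟨ sym (det-transpose (alternating N) (b ∘ τ) p q (q≢p ∘ sym)) ⟩
              det (b ∘ τ ∘ transpose p q) ≡⟨ det-reindex-fixing d (τ ∘ transpose p q) fixed′ ⟩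
              0#                          ∎)
      where
      p = fromℕ< d<N
      fixed′ : ∀ l → d ℕ.≤ toℕ l → τ (transpose p q l) ≡ l
      fixed′ l d≤l = case l ≟ p of λ where
        (yes refl) → trans (cong τ (transpose-at-i p q)) τq≡p
        (no  l≢p)  → let τl≡l = fixed l (above-position d<N l d≤l l≢p)
                         l≢q  = λ l≡q → l≢p (trans (sym τl≡l) (trans (cong τ l≡q) τq≡p))
                     in trans (cong τ (transpose-fixes p q l l≢p l≢q)) τl≡l

    det-reindex : ∀ τ → det (b ∘ τ) ≡ 0#
    det-reindex τ = det-reindex-fixing N τ (λ l N≤l → ⊥-elim (beyond-range (ℕ.<-irrefl refl) l N≤l))

    det-spanned : Spans b → ∀ d (X : Matrix N) (τ : Fin N → Fin N) →
      (∀ l → d ℕ.≤ toℕ l → X l ≗ b (τ l)) → det X ≡ 0#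
    det-spanned spans zero    X τ X≗bτ = trans (det-cong (λ l → X≗bτ l ℕ.z≤n)) (det-reindex τ)
    det-spanned spans (suc d) X τ X≗bτ with d ℕ.<? N
    ... | no  d≮N = det-spanned spans d X τ (λ l d≤l → ⊥-elim (beyond-range d≮N l d≤l))
    ... | yes d<N with spans (X (fromℕ< d<N))
    ...   | c , Σcb≡Xₚ = begin
      det X
        ≡⟨ det-linearCombination X p c X[p]≔b (λ j i i≢p → cong-app ([]≔-minimal X p (b j) i≢p)) X[p]≔Σcb ⟩
      ΣF (λ j → c j * det (X[p]≔b j))
        ≡⟨ ΣF-zero _ (λ j → trans (cong (c j *_) (det-spanned spans d (X[p]≔b j) (τ [ p ]≔ j) (replaced j))) (zeroʳ _)) ⟩
      0# ∎
      where
      p = fromℕ< d<N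
      X[p]≔b : Fin N → Matrix N
      X[p]≔b j = X [ p ]≔ b j
      X[p]≔Σcb : ∀ k → X p k ≡ ΣF (λ j → c j * X[p]≔b j p k)
      X[p]≔Σcb k = trans (sym (cong-app Σcb≡Xₚ k)) (ΣF-cong (λ j → cong (λ v → c j * v k) (sym ([]≔-updates X p (b j)))))
      replaced : ∀ j l → d ℕ.≤ toℕ l → X[p]≔b j l ≗ b ((τ [ p ]≔ j) l)
      replaced j l d≤l = case l ≟ p of λ where
        (yes refl) → cong-app (trans ([]≔-updates X p (b j)) (cong b (sym ([]≔-updates τ p j))))
        (no  l≢p)  → λ k → trans (cong-app ([]≔-minimal X p (b j) l≢p) k)
                               (trans (X≗bτ l (above-position d<N l d≤l l≢p) k)
                                      (cong (λ x → b x k) (sym ([]≔-minimal τ p j l≢p))))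

  det-spanning≢0 : ∀ {N} (b : Matrix N) → Spans b → det b ≢ 0#
  det-spanning≢0 {N} b spans det-b≡0 = 0≢1 (begin
    0#                   ≡⟨ sym (det-spanned b det-b≡0 spans N identityMatrix (λ l → l) unrestricted) ⟩
    det (identityMatrix {N}) ≡⟨ det-identity N ⟩
    1#                   ∎)
    where
    unrestricted : ∀ l → N ℕ.≤ toℕ l → identityMatrix l ≗ b l
    unrestricted l N≤l = ⊥-elim (beyond-range (ℕ.<-irrefl refl) l N≤l)

module ArcDeterminant (F : FiniteField) {n m : ℕ} (S : Fin m → FieldOps.Vec F (suc (suc n))) (a : Fin n → Fin m)
                      (arc : FieldOps.IsArc F S) (a-injective : ∀ {i j} → a i ≡ a j → i ≡ j) where
  open FieldOps F
  open FieldProperties F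
  open Determinant F
  open ≡-Reasoning

  -- dA S a u v reduces to det (rows u v), which is how the determinant lemmas apply to D below.
  rows : Vec (suc (suc n)) → Vec (suc (suc n)) → Matrix (suc (suc n))
  rows u v zero          = u
  rows u v (suc zero)    = v
  rows u v (suc (suc i)) = S (a i)

  D : Vec (suc (suc n)) → Vec (suc (suc n)) → Carrier
  D = dA S a

  IsLinear : (Vec (suc (suc n)) → Carrier) → Set
  IsLinear L = ∀ {r} (c : Fin r → Carrier) (w : Fin r → Vec (suc (suc n))) x →
    (∀ k → x k ≡ ΣF (λ i → c i * w i k)) → L x ≡ ΣF (λ i → c i * L (w i))

  eval-linear : ∀ α → IsLinear (eval α)
  eval-linear α c w x x≡Σcw = begin
    ΣF (λ k → α k * x k)                         ≡⟨ ΣF-cong (λ k → cong (α k *_) (x≡Σcw k)) ⟩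
    ΣF (λ k → α k * ΣF (λ i → c i * w i k))      ≡⟨ ΣF-cong (λ k → sym (ΣF-*ˡ (α k) (λ i → c i * w i k))) ⟩
    ΣF (λ k → ΣF (λ i → α k * (c i * w i k)))    ≡⟨ ΣF-comm (λ k i → α k * (c i * w i k)) ⟩
    ΣF (λ i → ΣF (λ k → α k * (c i * w i k)))
      ≡⟨ ΣF-cong (λ i → trans (ΣF-cong (λ k → *-leftComm (α k) (c i) (w i k))) (ΣF-*ˡ (c i) (λ k → α k * w i k))) ⟩
    ΣF (λ i → c i * eval α (w i))                ∎

  D-linearʳ : ∀ u → IsLinear (D u)
  D-linearʳ u c w x x≡Σcw = det-linearCombination (rows u x) (suc zero) c (λ i → rows u (w i)) agree x≡Σcw
    where
    agree : ∀ i l → l ≢ suc zero → rows u (w i) l ≗ rows u x l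
    agree i zero          _   = λ _ → refl
    agree i (suc zero)    1≢1 = ⊥-elim (1≢1 refl)
    agree i (suc (suc l)) _   = λ _ → refl

  D-self : ∀ u → D u u ≡ 0#
  D-self u = alternating _ (rows u u) zero (suc zero) (λ ()) (λ _ → refl)

  D-Aʳ : ∀ u j → D u (S (a j)) ≡ 0#
  D-Aʳ u j = alternating _ (rows u (S (a j))) (suc zero) (suc (suc j)) (λ ()) (λ _ → refl)

  D-antisym : ∀ u v → D u v ≡ - D v u
  D-antisym u v = det-transpose (alternating _) (rows v u) zero (suc zero) (λ ())

  OutsideA : Fin m → Set
  OutsideA u = ∀ j → a j ≢ u

  basisIndex : Fin m → Fin m → Fin (suc (suc n)) → Fin m
  basisIndex u v zero          = u
  basisIndex u v (suc zero)    = v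
  basisIndex u v (suc (suc i)) = a i

  basisIndex-injective : ∀ {u v} → u ≢ v → OutsideA u → OutsideA v → Injective (basisIndex u v)
  basisIndex-injective u≢v u∉A v∉A {zero}        {zero}        _  = refl
  basisIndex-injective u≢v u∉A v∉A {zero}        {suc zero}    eq = ⊥-elim (u≢v eq)
  basisIndex-injective u≢v u∉A v∉A {zero}        {suc (suc j)} eq = ⊥-elim (u∉A j (sym eq))
  basisIndex-injective u≢v u∉A v∉A {suc zero}    {zero}        eq = ⊥-elim (u≢v (sym eq))
  basisIndex-injective u≢v u∉A v∉A {suc zero}    {suc zero}    _  = refl
  basisIndex-injective u≢v u∉A v∉A {suc zero}    {suc (suc j)} eq = ⊥-elim (v∉A j (sym eq))
  basisIndex-injective u≢v u∉A v∉A {suc (suc i)} {zero}        eq = ⊥-elim (u∉A i eq)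
  basisIndex-injective u≢v u∉A v∉A {suc (suc i)} {suc zero}    eq = ⊥-elim (v∉A i eq)
  basisIndex-injective u≢v u∉A v∉A {suc (suc i)} {suc (suc j)} eq = cong (λ i → suc (suc i)) (a-injective eq)

  basis-spans : ∀ {u v} → u ≢ v → OutsideA u → OutsideA v → Spans (S ∘ basisIndex u v)
  basis-spans u≢v u∉A v∉A = proj₂ (proj₂ arc (basisIndex _ _) (basisIndex-injective u≢v u∉A v∉A))

  D-nonzero : ∀ {u v} → u ≢ v → OutsideA u → OutsideA v → D (S u) (S v) ≢ 0#
  D-nonzero u≢v u∉A v∉A = det-spanning≢0 (S ∘ basisIndex _ _) (basis-spans u≢v u∉A v∉A)

  -- c₀ and c₁ are the coordinates of x along S u and S v in the basis S ∘ basisIndex u v.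
  coordinates : ∀ {u v} → u ≢ v → OutsideA u → OutsideA v → ∀ x → ∃₂ λ c₀ c₁ → ∀ L → IsLinear L →
    (∀ j → L (S (a j)) ≡ 0#) → L x ≡ c₀ * L (S u) + c₁ * L (S v)
  coordinates {u} {v} u≢v u∉A v∉A x with basis-spans u≢v u∉A v∉A x
  ... | c , Σcb≡x = c zero , c (suc zero) , λ L L-linear L-A → begin
    L x                                      ≡⟨ L-linear c (S ∘ basisIndex u v) x (λ k → sym (cong-app Σcb≡x k)) ⟩
    c zero * L (S u) + (c (suc zero) * L (S v) + ΣF (λ j → c (suc (suc j)) * L (S (a j))))
      ≡⟨ cong (λ z → c zero * L (S u) + (c (suc zero) * L (S v) + z))
              (ΣF-zero _ (λ j → trans (cong (c (suc (suc j)) *_) (L-A j)) (zeroʳ _))) ⟩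
    c zero * L (S u) + (c (suc zero) * L (S v) + 0#)
      ≡⟨ cong (c zero * L (S u) +_) (+-identityʳ _) ⟩
    c zero * L (S u) + c (suc zero) * L (S v) ∎

  form-interpolation : ∀ α → (∀ j → eval α (S (a j)) ≡ 0#) → ∀ {u v} → u ≢ v → OutsideA u → OutsideA v → ∀ x →
    eval α x ≡ (eval α (S v) * D (S u) (S v) ⁻¹) * D (S u) x + (eval α (S u) * D (S v) (S u) ⁻¹) * D (S v) x
  form-interpolation α α-A {u} {v} u≢v u∉A v∉A x with coordinates u≢v u∉A v∉A x
  ... | c₀ , c₁ , expand = begin
    eval α x                                            ≡⟨ expand (eval α) (eval-linear α) α-A ⟩
    c₀ * eval α (S u) + c₁ * eval α (S v)               ≡⟨ +-comm _ _ ⟩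
    c₁ * eval α (S v) + c₀ * eval α (S u)               ≡⟨ cong₂ (λ y z → y * eval α (S v) + z * eval α (S u)) c₁≡ c₀≡ ⟩
    (D (S u) x * D (S u) (S v) ⁻¹) * eval α (S v) + (D (S v) x * D (S v) (S u) ⁻¹) * eval α (S u)
      ≡⟨ cong₂ _+_ (*-swapOuter _ _ _) (*-swapOuter _ _ _) ⟩
    (eval α (S v) * D (S u) (S v) ⁻¹) * D (S u) x + (eval α (S u) * D (S v) (S u) ⁻¹) * D (S v) x ∎
    where
    c₁≡ : c₁ ≡ D (S u) x * D (S u) (S v) ⁻¹
    c₁≡ = *-⁻¹-solve (D-nonzero u≢v u∉A v∉A) (sym (begin
      D (S u) x                                   ≡⟨ expand (D (S u)) (D-linearʳ (S u)) (D-Aʳ (S u)) ⟩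
      c₀ * D (S u) (S u) + c₁ * D (S u) (S v)     ≡⟨ cong (λ z → c₀ * z + c₁ * D (S u) (S v)) (D-self (S u)) ⟩
      c₀ * 0# + c₁ * D (S u) (S v)                ≡⟨ trans (cong (_+ c₁ * D (S u) (S v)) (zeroʳ c₀)) (+-identityˡ _) ⟩
      c₁ * D (S u) (S v)                          ∎))
    c₀≡ : c₀ ≡ D (S v) x * D (S v) (S u) ⁻¹
    c₀≡ = *-⁻¹-solve (D-nonzero (u≢v ∘ sym) v∉A u∉A) (sym (begin
      D (S v) x                                   ≡⟨ expand (D (S v)) (D-linearʳ (S v)) (D-Aʳ (S v)) ⟩
      c₀ * D (S v) (S u) + c₁ * D (S v) (S v)     ≡⟨ cong (λ z → c₀ * D (S v) (S u) + c₁ * z) (D-self (S v)) ⟩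
      c₀ * D (S v) (S u) + c₁ * 0#                ≡⟨ trans (cong (c₀ * D (S v) (S u) +_) (zeroʳ c₁)) (+-identityʳ _) ⟩
      c₀ * D (S v) (S u)                          ∎))

  open Counting

  d : Fin m → Fin m → Carrier
  d u v = D (S u) (S v)

  weight : (Fin m → Bool) → Fin m → Carrier
  weight P e = ΠF (λ u → if (P ∖ e) u then d u e ⁻¹ else 1#)

  lagrangeSum : (Fin m → Bool) → (Fin m → Carrier) → Carrier
  lagrangeSum P g = ΣF (λ e → if P e then g e * weight P e else 0#)

  OutsideAll : (Fin m → Bool) → Set
  OutsideAll P = ∀ u → P u ≡ true → OutsideA u

  lagrangeSum-cong : ∀ P {g g′ : Fin m → Carrier} → (∀ x → P x ≡ true → g x ≡ g′ x) →
                     lagrangeSum P g ≡ lagrangeSum P g′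
  lagrangeSum-cong P {g} {g′} g≗g′ = ΣF-cong term
    where
    term : ∀ e → (if P e then g e * weight P e else 0#) ≡ (if P e then g′ e * weight P e else 0#)
    term e with P e in Pe
    ... | true  = cong (_* weight P e) (g≗g′ e Pe)
    ... | false = refl

  lagrangeSum-linear : ∀ P c c′ (g g′ : Fin m → Carrier) →
    lagrangeSum P (λ x → c * g x + c′ * g′ x) ≡ c * lagrangeSum P g + c′ * lagrangeSum P g′
  lagrangeSum-linear P c c′ g g′ = trans (ΣF-cong term) (ΣF-linear c c′ (summand g) (summand g′))
    where
    summand : (Fin m → Carrier) → Fin m → Carrier
    summand f e = if P e then f e * weight P e else 0#
    term : ∀ e → summand (λ x → c * g x + c′ * g′ x) e ≡ c * summand g e + c′ * summand g′ e
    term e with P e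
    ... | true  = trans (distribʳ _ _ _) (cong₂ _+_ (*-assoc _ _ _) (*-assoc _ _ _))
    ... | false = sym (trans (cong₂ _+_ (zeroʳ c) (zeroʳ c′)) (+-identityˡ 0#))

  weight-∖ : ∀ {P p e} → P p ≡ true → p ≢ e → weight P e ≡ d p e ⁻¹ * weight (P ∖ p) e
  weight-∖ {P} {p} {e} Pp p≢e = begin
    ΠF factor                        ≡⟨ ΠF-extract factor p ⟩
    factor p * ΠF (factor [ p ]≔ 1#) ≡⟨ cong₂ _*_ factor-p (ΠF-cong factor-∖) ⟩
    d p e ⁻¹ * weight (P ∖ p) e      ∎
    where
    factor : Fin m → Carrier
    factor u = if (P ∖ e) u then d u e ⁻¹ else 1#
    factor-p : factor p ≡ d p e ⁻¹
    factor-p = cong (λ b → if b then d p e ⁻¹ else 1#) (trans (∖-other P e p≢e) Pp)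
    factor-∖ : ∀ u → (factor [ p ]≔ 1#) u ≡ (if ((P ∖ p) ∖ e) u then d u e ⁻¹ else 1#)
    factor-∖ u = case u ≟ p of λ where
      (yes refl) → trans ([]≔-updates factor p 1#)
                         (sym (cong (λ b → if b then d p e ⁻¹ else 1#) (trans (∖-other (P ∖ p) e p≢e) (∖-self P p))))
      (no  u≢p)  → trans ([]≔-minimal factor p 1# u≢p)
                         (cong (λ b → if b ∧ not (does (u ≟ e)) then d u e ⁻¹ else 1#) (sym (∖-other P p u≢p)))

  lagrangeSum-∖ : ∀ {P p} (h : Fin m → Carrier) → OutsideAll P → P p ≡ true →
    lagrangeSum P (λ x → d p x * h x) ≡ lagrangeSum (P ∖ p) h
  lagrangeSum-∖ {P} {p} h P-outside Pp = ΣF-cong term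
    where
    term : ∀ e → (if P e then (d p e * h e) * weight P e else 0#) ≡ (if (P ∖ p) e then h e * weight (P ∖ p) e else 0#)
    term e with e ≟ p
    ... | yes refl rewrite Pp = begin
      (d p p * h p) * weight P p   ≡⟨ cong (λ z → (z * h p) * weight P p) (D-self (S p)) ⟩
      (0# * h p) * weight P p      ≡⟨ trans (cong (_* weight P p) (zeroˡ _)) (zeroˡ _) ⟩
      0#                           ∎
    ... | no  e≢p with P e in Pe
    ...   | false = refl
    ...   | true  = begin
      (d p e * h e) * weight P e                    ≡⟨ cong (d p e * h e *_) (weight-∖ Pp (e≢p ∘ sym)) ⟩
      (d p e * h e) * (d p e ⁻¹ * weight (P ∖ p) e)
        ≡⟨ x*y*[x⁻¹*z]≡y*z _ _ (D-nonzero (e≢p ∘ sym) (P-outside p Pp) (P-outside e Pe)) ⟩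
      h e * weight (P ∖ p) e                        ∎

  lagrangeSum-singleton : ∀ {P q} (h : Fin m → Carrier) → count P ≡ 1 → P q ≡ true → lagrangeSum P h ≡ h q
  lagrangeSum-singleton {P} {q} h count≡1 Pq = begin
    lagrangeSum P h
      ≡⟨ ΣF-single _ q (λ u u≢q → cong (λ b → if b then h u * weight P u else 0#) (only-q u u≢q)) ⟩
    (if P q then h q * weight P q else 0#)       ≡⟨ cong (λ b → if b then h q * weight P q else 0#) Pq ⟩
    h q * weight P q
      ≡⟨ cong (h q *_) (ΠF-one _ (λ u → cong (λ b → if b then d u q ⁻¹ else 1#) (empty u))) ⟩
    h q * 1#                                     ≡⟨ *-identityʳ _ ⟩
    h q                                          ∎
    where
    empty : ∀ u → (P ∖ q) u ≡ false
    empty = count-zero (P ∖ q) (count-∖-pred P Pq count≡1)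
    only-q : ∀ u → u ≢ q → P u ≡ false
    only-q u u≢q = trans (sym (∖-other P q u≢q)) (empty u)

  lagrangeSum-split : ∀ {P p p′} (g h : Fin m → Carrier) c c′ → OutsideAll P → P p ≡ true → P p′ ≡ true →
    (∀ x → P x ≡ true → g x ≡ (c * d p x + c′ * d p′ x) * h x) →
    lagrangeSum P g ≡ c * lagrangeSum (P ∖ p) h + c′ * lagrangeSum (P ∖ p′) h
  lagrangeSum-split {P} {p} {p′} g h c c′ P-outside Pp Pp′ g≡ = begin
    lagrangeSum P g
      ≡⟨ lagrangeSum-cong P (λ x Px → trans (g≡ x Px) (trans (distribʳ _ _ _) (cong₂ _+_ (*-assoc _ _ _) (*-assoc _ _ _)))) ⟩
    lagrangeSum P (λ x → c * (d p x * h x) + c′ * (d p′ x * h x))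
      ≡⟨ lagrangeSum-linear P c c′ _ _ ⟩
    c * lagrangeSum P (λ x → d p x * h x) + c′ * lagrangeSum P (λ x → d p′ x * h x)
      ≡⟨ cong₂ (λ y z → c * y + c′ * z) (lagrangeSum-∖ h P-outside Pp) (lagrangeSum-∖ h P-outside Pp′) ⟩
    c * lagrangeSum (P ∖ p) h + c′ * lagrangeSum (P ∖ p′) h ∎

  inverse-weights-sum : ∀ {u v} → u ≢ v → OutsideA u → OutsideA v → d v u ⁻¹ * d v v + d u v ⁻¹ * d u v ≡ 1#
  inverse-weights-sum {u} {v} u≢v u∉A v∉A = begin
    d v u ⁻¹ * d v v + d u v ⁻¹ * d u v  ≡⟨ cong (λ z → d v u ⁻¹ * z + d u v ⁻¹ * d u v) (D-self (S v)) ⟩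
    d v u ⁻¹ * 0# + d u v ⁻¹ * d u v     ≡⟨ trans (cong (_+ d u v ⁻¹ * d u v) (zeroʳ _)) (+-identityˡ _) ⟩
    d u v ⁻¹ * d u v                     ≡⟨ trans (*-comm _ _) (⁻¹-inverse _ (D-nonzero u≢v u∉A v∉A)) ⟩
    1#                                   ∎

  lagrangeSum-pair : ∀ P → count P ≡ 2 → OutsideAll P → lagrangeSum P (λ _ → 1#) ≡ 0#
  lagrangeSum-pair P count≡2 P-outside with two-elements P count≡2
  ... | p , p′ , Pp , P∖pₚ′ = begin
    lagrangeSum P (λ _ → 1#)
      ≡⟨ lagrangeSum-split (λ _ → 1#) (λ _ → 1#) (d p p′ ⁻¹) (d p′ p ⁻¹) P-outside Pp Pp′ one-on-P ⟩
    d p p′ ⁻¹ * lagrangeSum (P ∖ p) (λ _ → 1#) + d p′ p ⁻¹ * lagrangeSum (P ∖ p′) (λ _ → 1#)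
      ≡⟨ cong₂ (λ y z → d p p′ ⁻¹ * y + d p′ p ⁻¹ * z)
               (lagrangeSum-singleton _ (count-∖-pred P Pp count≡2) P∖pₚ′)
               (lagrangeSum-singleton _ (count-∖-pred P Pp′ count≡2) (trans (∖-other P p′ (p′≢p ∘ sym)) Pp)) ⟩
    d p p′ ⁻¹ * 1# + d p′ p ⁻¹ * 1#      ≡⟨ cong₂ _+_ (*-identityʳ _) (*-identityʳ _) ⟩
    d p p′ ⁻¹ + d p′ p ⁻¹                ≡⟨ cong (d p p′ ⁻¹ +_) (trans (cong _⁻¹ (D-antisym (S p′) (S p)))
                                                                     (⁻¹-neg _ (D-nonzero (p′≢p ∘ sym) p∉A p′∉A))) ⟩
    d p p′ ⁻¹ + - (d p p′ ⁻¹)            ≡⟨ -‿inverseʳ _ ⟩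
    0#                                   ∎
    where
    Pp′ = ∖-⊆ P p P∖pₚ′
    p′≢p = ∖-≢ P p P∖pₚ′
    p∉A = P-outside p Pp
    p′∉A = P-outside p′ Pp′
    one-on-P : ∀ x → P x ≡ true → 1# ≡ (d p p′ ⁻¹ * d p x + d p′ p ⁻¹ * d p′ x) * 1#
    one-on-P x Px = sym (trans (*-identityʳ _) (case count≡2⇒either P count≡2 Pp P∖pₚ′ x Px of λ where
      (inj₁ refl) → inverse-weights-sum p′≢p p′∉A p∉A
      (inj₂ refl) → trans (+-comm _ _) (inverse-weights-sum (p′≢p ∘ sym) p∉A p′∉A)))

  lagrangeSum-vanishes : ∀ t P → count P ≡ suc (suc t) → OutsideAll P → (α : Fin t → Form (suc (suc n))) →
    (∀ i j → eval (α i) (S (a j)) ≡ 0#) → lagrangeSum P (λ x → fA α (S x)) ≡ 0#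
  lagrangeSum-vanishes zero    P count≡2 P-outside _ _ = lagrangeSum-pair P count≡2 P-outside
  lagrangeSum-vanishes (suc t) P count≡ P-outside α α-A with two-elements P count≡
  ... | p , p′ , Pp , P∖pₚ′ = begin
    lagrangeSum P (λ x → fA α (S x))
      ≡⟨ lagrangeSum-split _ h c c′ P-outside Pp Pp′
           (λ x _ → cong (_* h x) (form-interpolation (α zero) (α-A zero) (p′≢p ∘ sym) p∉A p′∉A (S x))) ⟩
    c * lagrangeSum (P ∖ p) h + c′ * lagrangeSum (P ∖ p′) h
      ≡⟨ cong₂ (λ y z → c * y + c′ * z) (vanishes-without Pp) (vanishes-without Pp′) ⟩
    c * 0# + c′ * 0#         ≡⟨ cong₂ _+_ (zeroʳ c) (zeroʳ c′) ⟩
    0# + 0#                  ≡⟨ +-identityˡ 0# ⟩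
    0#                       ∎
    where
    Pp′ = ∖-⊆ P p P∖pₚ′
    p′≢p = ∖-≢ P p P∖pₚ′
    p∉A = P-outside p Pp
    p′∉A = P-outside p′ Pp′
    h : Fin m → Carrier
    h x = fA (α ∘ suc) (S x)
    c = eval (α zero) (S p′) * d p p′ ⁻¹
    c′ = eval (α zero) (S p) * d p′ p ⁻¹
    vanishes-without : ∀ {q} → P q ≡ true → lagrangeSum (P ∖ q) h ≡ 0#
    vanishes-without Pq = lagrangeSum-vanishes t (P ∖ _) (count-∖-pred P Pq count≡)
      (λ u P∖qᵤ → P-outside u (∖-⊆ P _ P∖qᵤ)) (α ∘ suc) (α-A ∘ suc)

  withoutA : Subset m → Fin m → Bool
  withoutA E u = inSub E u ∧ not (inA a u)

  identitySum≡lagrangeSum : ∀ {t} (α : Fin t → Form (suc (suc n))) E →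
    identitySum S a α E ≡ lagrangeSum (withoutA E) (λ x → fA α (S x))
  identitySum≡lagrangeSum α E = ΣF-cong λ e → cong (λ w → if withoutA E e then fA α (S e) * w else 0#) (ΠF-cong λ u →
    cong (λ b → if b then d u e ⁻¹ else 1#)
         (trans (cong (λ b → inSub E u ∧ (not (inA a u) ∧ not b)) (isYes≗does (u ≟ e))) (sym (∧-assoc (inSub E u) _ _))))

  inA-image : ∀ j → inA a (a j) ≡ true
  inA-image j = trans (isYes≗does _) (dec-true (any? (λ i → a i ≟ a j)) (j , refl))

  withoutA-outside : ∀ E → OutsideAll (withoutA E)
  withoutA-outside E u E∖Aᵤ j refl with trans (sym E∖Aᵤ) (trans (cong (λ b → inSub E (a j) ∧ not b) (inA-image j)) (∧-zeroʳ _))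
  ... | ()

  count-withoutA : ∀ E → (∀ j → a j ∈ E) → count (withoutA E) ℕ.+ n ≡ ∣ E ∣
  count-withoutA E A⊆E = begin
    count (withoutA E) ℕ.+ n
      ≡⟨ cong (ℕ._+ n) (count-cong λ u →
           cong₂ (λ x y → x ∧ not y) (isYes≗does (u ∈? E)) (isYes≗does (any? (λ j → a j ≟ u)))) ⟩
    count (λ u → does (u ∈? E) ∧ not (does (any? (λ j → a j ≟ u)))) ℕ.+ n
      ≡⟨ count-image a a-injective (λ u → does (u ∈? E)) (λ j → dec-true (a j ∈? E) (A⊆E j)) ⟩
    count (λ u → does (u ∈? E))        ≡⟨ count-∈ E ⟩
    ∣ E ∣                              ∎

strictlyIncreasing⇒injective : ∀ F {n m} {a : Fin n → Fin m} → FieldOps.StrictlyIncreasing F a → ∀ {i j} → a i ≡ a j → i ≡ j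
strictlyIncreasing⇒injective F increasing {i} {j} aᵢ≡aⱼ with <-cmp i j
... | tri< i<j _ _ = ⊥-elim (<-irrefl aᵢ≡aⱼ (increasing i j i<j))
... | tri≈ _ i≡j _ = i≡j
... | tri> _ _ j<i = ⊥-elim (<-irrefl (sym aᵢ≡aⱼ) (increasing j i j<i))

open import Data.Nat using (ℕ; suc; _+_; _∸_; _≤_)
open import Data.Fin using (Fin)
open import Data.Fin.Subset using (Subset; _∈_; ∣_∣)
open import Data.Product using (∃)
open import Function.Bundles using (_⇔_)
open import Relation.Binary.PropositionalEquality using (_≡_)
open FieldOps using (Vec; IsArc; StrictlyIncreasing; Form; PairwiseLinearlyIndependent; eval; identitySum)
open FiniteField using (q; 0#)

lemma2p4 : (F : FiniteField) (n : ℕ) → 1 ≤ n →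
    (m : ℕ) (S : Fin m → Vec F (suc (suc n))) → IsArc F S →
    (a : Fin n → Fin m) → StrictlyIncreasing F a →
    (α : Fin (q F + suc n ∸ m) → Form F (suc (suc n))) →
    PairwiseLinearlyIndependent F α →
    (∀ i s → (eval F (α i) (S s) ≡ 0# F) ⇔ (∃ λ j → a j ≡ s)) →
    (E : Subset m) → ∣ E ∣ ≡ (q F + suc n ∸ m) + suc (suc n) →
    (∀ j → a j ∈ E) →
    identitySum F S a α E ≡ 0# F
lemma2p4 F n _ m S arc a increasing α _ α-zeros E ∣E∣≡ A⊆E = begin
  identitySum F S a α E                       ≡⟨ identitySum≡lagrangeSum α E ⟩
  lagrangeSum (withoutA E) (λ x → fA α (S x)) ≡⟨ lagrangeSum-vanishes t (withoutA E) count≡ (withoutA-outside E) α α-A ⟩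
  0# F                                        ∎
  where
  open ≡-Reasoning
  open FieldOps F using (fA)
  open ArcDeterminant F S a arc (strictlyIncreasing⇒injective F increasing)
  open Counting using (count)
  t = q F + suc n ∸ m
  α-A : ∀ i j → eval F (α i) (S (a j)) ≡ 0# F
  α-A i j = Equivalence.from (α-zeros i (a j)) (j , refl)
  count≡ : count (withoutA E) ≡ suc (suc t)
  count≡ = ℕ.+-cancelʳ-≡ n _ _ (begin
    count (withoutA E) + n  ≡⟨ count-withoutA E A⊆E ⟩
    ∣ E ∣                   ≡⟨ ∣E∣≡ ⟩
    t + suc (suc n)         ≡⟨ trans (ℕ.+-suc t (suc n)) (cong suc (ℕ.+-suc t n)) ⟩
    suc (suc t) + n         ∎)
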